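{- Over the calculus QHC (described in the context), the following equivalences of principles hold (each displayed schema is understood for all formulas of the indicated sorts): (a) The $?^*$-Principle $(?\alpha\to ?\beta)\leftrightarrow ?(\nabla\alpha\to\nabla\beta)$ is equivalent to each of: $(?!p\to ?!q)\leftrightarrow ?(!p\to !q)$; $(?\alpha\to ?\beta)\leftrightarrow\Box(?\alpha\to ?\beta)$. (b) The $\forall^*$-Principle $\forall x\,?\alpha(x)\leftrightarrow ?\forall x\,\nabla\alpha(x)$ is equivalent to each of: $\forall x\,?!p(x)\leftrightarrow ?\forall x\,!p(x)$; $\forall x\,?\alpha(x)\leftrightarrow\Box\forall x\,?\alpha(x)$; $\forall x\,\Box p(x)\leftrightarrow\Box\forall x\,p(x)$. (c) The $\lor^*$-Principle $!p\lor !q\leftrightarrow !(\Box p\lor\Box q)$ is equivalent to each of: $(!?\alpha\lor !?\beta)\leftrightarrow !(?\alpha\lor ?\beta)$; $(!p\lor !q)\leftrightarrow\nabla(!p\lor !q)$; $\nabla\alpha\lor\nabla\beta\leftrightarrow\nabla(\alpha\lor\beta)$. (d) The $\exists^*$-Principle $\exists x\,!p(x)\leftrightarrow !\exists x\,\Box p(x)$ is equivalent to each of: $\exists x\,!?\alpha(x)\leftrightarrow !\exists x\,?\alpha(x)$; $\exists x\,!p(x)\leftrightarrow\nabla\exists x\,!p(x)$; $\exists x\,\nabla\alpha(x)\leftrightarrow\nabla\exists x\,\alpha(x)$.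
   Context: QHC (the joint logic of problems and propositions) is a two-sorted first-order calculus over a single domain of individuals. Formulas are of two sorts: propositions (letters $p,q$) and problems (letters $\alpha,\beta$). Propositions are built from atomic propositions and from expressions $?\alpha$ ($\alpha$ a problem) by the classical connectives $\land,\lor,\to,\neg$, the constant $0$ (falsity) and quantifiers $\forall x,\exists x$. Problems are built from atomic problems and from expressions $!p$ ($p$ a proposition) by the intuitionistic connectives $\land,\lor,\to,\neg$, the constant $\bot$ and quantifiers $\forall x,\exists x$. Derivability in QHC: all axioms and rules of classical predicate logic apply to propositions, all axioms and rules of intuitionistic predicate logic apply to problems, and in addition there are the inference rules "from $\alpha$ infer $?\alpha$" and "from $p$ infer $!p$", and the axiom schemes $?(\alpha\to\beta)\to(?\alpha\to ?\beta)$, $!(p\to q)\to(!p\to !q)$, $\neg !0$, $?!p\to p$, $\alpha\to !?\alpha$. Abbreviations: $\Box p:= ?!p$ for propositions, $\nabla\alpha := !?\alpha$ for problems; $A\leftrightarrow B$ abbreviates $(A\to B)\land(B\to A)$ in the appropriate sort. A "principle" is a schema added to QHC as extra axioms (all instances, for arbitrary formulas of the indicated sorts and variables $x$). Two principles are equivalent if each is derivable in QHC extended by the other. -}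

module Defs where

open import Data.Nat using (ℕ; suc)
open import Data.Fin using (Fin; zero; suc)
open import Data.Vec using (Vec; []; _∷_)
open import Data.Product using (_×_)
open import Data.Empty using () renaming (⊥ to Empty)
open import Level using (0ℓ)
open import Agda.Primitive using (lsuc)

-- Syntax of QHC (de Bruijn indices; n = number of free individual variables)

data Term (n : ℕ) : Set where
  var : Fin n → Term n
  fun : (f k : ℕ) → Vec (Term n) k → Term n

infixr 4 _⇒_
infixr 6 _∧_
infixr 5 _∨_
infix  8 ¬_

mutual
  -- propositions (classical sort)
  data Prp (n : ℕ) : Set where
    patom : (r k : ℕ) → Vec (Term n) k → Prp n
    ¿_    : Prb n → Prp n
    _∧_ _∨_ _⇒_ : Prp n → Prp n → Prp n
    ¬_    : Prp n → Prp n
    𝟘     : Prp n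
    ∀' ∃' : Prp (suc n) → Prp n

  -- problems (intuitionistic sort)
  data Prb (n : ℕ) : Set where
    batom : (r k : ℕ) → Vec (Term n) k → Prb n
    !_    : Prp n → Prb n
    _∧_ _∨_ _⇒_ : Prb n → Prb n → Prb n
    ¬_    : Prb n → Prb n
    ⊥'    : Prb n
    ∀' ∃' : Prb (suc n) → Prb n

infix 9 ¿_ !_

Sub : ℕ → ℕ → Set
Sub n m = Fin n → Term m

mutual
  substTm : ∀ {n m} → Sub n m → Term n → Term m
  substTm σ (var i)      = σ i
  substTm σ (fun f k ts) = fun f k (substTms σ ts)

  substTms : ∀ {n m k} → Sub n m → Vec (Term n) k → Vec (Term m) k
  substTms σ []       = []
  substTms σ (t ∷ ts) = substTm σ t ∷ substTms σ ts

liftS : ∀ {n m} → Sub n m → Sub (suc n) (suc m)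
liftS σ zero    = var zero
liftS σ (suc i) = substTm (λ j → var (suc j)) (σ i)

mutual
  substP : ∀ {n m} → Sub n m → Prp n → Prp m
  substP σ (patom r k ts) = patom r k (substTms σ ts)
  substP σ (¿ α)   = ¿ substB σ α
  substP σ (A ∧ B) = substP σ A ∧ substP σ B
  substP σ (A ∨ B) = substP σ A ∨ substP σ B
  substP σ (A ⇒ B) = substP σ A ⇒ substP σ B
  substP σ (¬ A)   = ¬ substP σ A
  substP σ 𝟘       = 𝟘
  substP σ (∀' A)  = ∀' (substP (liftS σ) A)
  substP σ (∃' A)  = ∃' (substP (liftS σ) A)

  substB : ∀ {n m} → Sub n m → Prb n → Prb m
  substB σ (batom r k ts) = batom r k (substTms σ ts)
  substB σ (! p)   = ! substP σ p
  substB σ (A ∧ B) = substB σ A ∧ substB σ B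
  substB σ (A ∨ B) = substB σ A ∨ substB σ B
  substB σ (A ⇒ B) = substB σ A ⇒ substB σ B
  substB σ (¬ A)   = ¬ substB σ A
  substB σ ⊥'      = ⊥'
  substB σ (∀' A)  = ∀' (substB (liftS σ) A)
  substB σ (∃' A)  = ∃' (substB (liftS σ) A)

wkP : ∀ {n} → Prp n → Prp (suc n)
wkP = substP (λ i → var (suc i))

wkB : ∀ {n} → Prb n → Prb (suc n)
wkB = substB (λ i → var (suc i))

sub0 : ∀ {n} → Term n → Sub (suc n) n
sub0 t zero    = t
sub0 t (suc i) = var i

instP : ∀ {n} → Prp (suc n) → Term n → Prp n
instP A t = substP (sub0 t) A

instB : ∀ {n} → Prb (suc n) → Term n → Prb n
instB A t = substB (sub0 t) A

_⇔ₚ_ : ∀ {n} → Prp n → Prp n → Prp n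
A ⇔ₚ B = (A ⇒ B) ∧ (B ⇒ A)

_⇔ᵦ_ : ∀ {n} → Prb n → Prb n → Prb n
A ⇔ᵦ B = (A ⇒ B) ∧ (B ⇒ A)

infix 3 _⇔ₚ_ _⇔ᵦ_

□ : ∀ {n} → Prp n → Prp n
□ p = ¿ ! p

∇ : ∀ {n} → Prb n → Prb n
∇ α = ! ¿ α

-- Extra axioms (a principle = set of all its instances, in both sorts)

record Principle : Set₁ where
  field
    AxP : ∀ {n} → Prp n → Set
    AxB : ∀ {n} → Prb n → Set
open Principle public

propPrinciple : (∀ {n} → Prp n → Set) → Principle
propPrinciple S = record { AxP = S ; AxB = λ _ → Empty }

probPrinciple : (∀ {n} → Prb n → Set) → Principle
probPrinciple S = record { AxP = λ _ → Empty ; AxB = S }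

infix 2 _⊢ₚ_ _⊢ᵦ_

mutual
  data _⊢ₚ_ (X : Principle) : ∀ {n} → Prp n → Set where
    K    : ∀ {n} {A B : Prp n} → X ⊢ₚ A ⇒ (B ⇒ A)
    S    : ∀ {n} {A B C : Prp n} → X ⊢ₚ (A ⇒ B) ⇒ ((A ⇒ (B ⇒ C)) ⇒ (A ⇒ C))
    ∧I   : ∀ {n} {A B : Prp n} → X ⊢ₚ A ⇒ (B ⇒ (A ∧ B))
    ∧E₁  : ∀ {n} {A B : Prp n} → X ⊢ₚ (A ∧ B) ⇒ A
    ∧E₂  : ∀ {n} {A B : Prp n} → X ⊢ₚ (A ∧ B) ⇒ B
    ∨I₁  : ∀ {n} {A B : Prp n} → X ⊢ₚ A ⇒ (A ∨ B)
    ∨I₂  : ∀ {n} {A B : Prp n} → X ⊢ₚ B ⇒ (A ∨ B)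
    ∨E   : ∀ {n} {A B C : Prp n} → X ⊢ₚ (A ⇒ C) ⇒ ((B ⇒ C) ⇒ ((A ∨ B) ⇒ C))
    ¬I   : ∀ {n} {A B : Prp n} → X ⊢ₚ (A ⇒ B) ⇒ ((A ⇒ ¬ B) ⇒ ¬ A)
    ¬E   : ∀ {n} {A B : Prp n} → X ⊢ₚ ¬ A ⇒ (A ⇒ B)
    𝟘E   : ∀ {n} {A : Prp n} → X ⊢ₚ 𝟘 ⇒ A
    DNE  : ∀ {n} {A : Prp n} → X ⊢ₚ ¬ ¬ A ⇒ A
    MP   : ∀ {n} {A B : Prp n} → X ⊢ₚ A ⇒ B → X ⊢ₚ A → X ⊢ₚ B
    ∀E   : ∀ {n} (A : Prp (suc n)) (t : Term n) → X ⊢ₚ ∀' A ⇒ instP A t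
    ∃I   : ∀ {n} (A : Prp (suc n)) (t : Term n) → X ⊢ₚ instP A t ⇒ ∃' A
    Gen  : ∀ {n} {C : Prp n} {A : Prp (suc n)} → X ⊢ₚ wkP C ⇒ A → X ⊢ₚ C ⇒ ∀' A
    ∃E   : ∀ {n} {C : Prp n} {A : Prp (suc n)} → X ⊢ₚ A ⇒ wkP C → X ⊢ₚ ∃' A ⇒ C
    ?R   : ∀ {n} {α : Prb n} → X ⊢ᵦ α → X ⊢ₚ ¿ α
    ?K   : ∀ {n} {α β : Prb n} → X ⊢ₚ ¿ (α ⇒ β) ⇒ (¿ α ⇒ ¿ β)
    ?!T  : ∀ {n} {p : Prp n} → X ⊢ₚ ¿ ! p ⇒ p
    axP  : ∀ {n} {A : Prp n} → AxP X A → X ⊢ₚ A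

  data _⊢ᵦ_ (X : Principle) : ∀ {n} → Prb n → Set where
    K    : ∀ {n} {A B : Prb n} → X ⊢ᵦ A ⇒ (B ⇒ A)
    S    : ∀ {n} {A B C : Prb n} → X ⊢ᵦ (A ⇒ B) ⇒ ((A ⇒ (B ⇒ C)) ⇒ (A ⇒ C))
    ∧I   : ∀ {n} {A B : Prb n} → X ⊢ᵦ A ⇒ (B ⇒ (A ∧ B))
    ∧E₁  : ∀ {n} {A B : Prb n} → X ⊢ᵦ (A ∧ B) ⇒ A
    ∧E₂  : ∀ {n} {A B : Prb n} → X ⊢ᵦ (A ∧ B) ⇒ B
    ∨I₁  : ∀ {n} {A B : Prb n} → X ⊢ᵦ A ⇒ (A ∨ B)
    ∨I₂  : ∀ {n} {A B : Prb n} → X ⊢ᵦ B ⇒ (A ∨ B)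
    ∨E   : ∀ {n} {A B C : Prb n} → X ⊢ᵦ (A ⇒ C) ⇒ ((B ⇒ C) ⇒ ((A ∨ B) ⇒ C))
    ¬I   : ∀ {n} {A B : Prb n} → X ⊢ᵦ (A ⇒ B) ⇒ ((A ⇒ ¬ B) ⇒ ¬ A)
    ¬E   : ∀ {n} {A B : Prb n} → X ⊢ᵦ ¬ A ⇒ (A ⇒ B)
    ⊥E   : ∀ {n} {A : Prb n} → X ⊢ᵦ ⊥' ⇒ A
    MP   : ∀ {n} {A B : Prb n} → X ⊢ᵦ A ⇒ B → X ⊢ᵦ A → X ⊢ᵦ B
    ∀E   : ∀ {n} (A : Prb (suc n)) (t : Term n) → X ⊢ᵦ ∀' A ⇒ instB A t
    ∃I   : ∀ {n} (A : Prb (suc n)) (t : Term n) → X ⊢ᵦ instB A t ⇒ ∃' A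
    Gen  : ∀ {n} {C : Prb n} {A : Prb (suc n)} → X ⊢ᵦ wkB C ⇒ A → X ⊢ᵦ C ⇒ ∀' A
    ∃E   : ∀ {n} {C : Prb n} {A : Prb (suc n)} → X ⊢ᵦ A ⇒ wkB C → X ⊢ᵦ ∃' A ⇒ C
    !R   : ∀ {n} {p : Prp n} → X ⊢ₚ p → X ⊢ᵦ ! p
    !K   : ∀ {n} {p q : Prp n} → X ⊢ᵦ ! (p ⇒ q) ⇒ (! p ⇒ ! q)
    ¬!0  : ∀ {n} → X ⊢ᵦ ¬ (! (𝟘 {n}))
    unit : ∀ {n} {α : Prb n} → X ⊢ᵦ α ⇒ ! ¿ α
    axB  : ∀ {n} {A : Prb n} → AxB X A → X ⊢ᵦ A

_⊑_ : Principle → Principle → Set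
P ⊑ Q = (∀ {n} (A : Prp n) → AxP Q A → P ⊢ₚ A)
      × (∀ {n} (A : Prb n) → AxB Q A → P ⊢ᵦ A)

_≋_ : Principle → Principle → Set
P ≋ Q = (P ⊑ Q) × (Q ⊑ P)

infix 1 _⊑_ _≋_

data ?StarI : ∀ {n} → Prp n → Set where
  inst : ∀ {n} (α β : Prb n) → ?StarI ((¿ α ⇒ ¿ β) ⇔ₚ ¿ (∇ α ⇒ ∇ β))

data ?StarII : ∀ {n} → Prp n → Set where
  inst : ∀ {n} (p q : Prp n) → ?StarII ((¿ ! p ⇒ ¿ ! q) ⇔ₚ ¿ (! p ⇒ ! q))

data ?StarIII : ∀ {n} → Prp n → Set where
  inst : ∀ {n} (α β : Prb n) → ?StarIII ((¿ α ⇒ ¿ β) ⇔ₚ □ (¿ α ⇒ ¿ β))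

-- (b)   α(x), p(x) : formulas in which variable 0 (= x) may occur
data ∀StarI : ∀ {n} → Prp n → Set where
  inst : ∀ {n} (α : Prb (suc n)) → ∀StarI (∀' (¿ α) ⇔ₚ ¿ ∀' (∇ α))

data ∀StarII : ∀ {n} → Prp n → Set where
  inst : ∀ {n} (p : Prp (suc n)) → ∀StarII (∀' (¿ ! p) ⇔ₚ ¿ ∀' (! p))

data ∀StarIII : ∀ {n} → Prp n → Set where
  inst : ∀ {n} (α : Prb (suc n)) → ∀StarIII (∀' (¿ α) ⇔ₚ □ (∀' (¿ α)))

data ∀StarIV : ∀ {n} → Prp n → Set where
  inst : ∀ {n} (p : Prp (suc n)) → ∀StarIV (∀' (□ p) ⇔ₚ □ (∀' p))

data ∨StarI : ∀ {n} → Prb n → Set where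
  inst : ∀ {n} (p q : Prp n) → ∨StarI ((! p ∨ ! q) ⇔ᵦ ! (□ p ∨ □ q))

data ∨StarII : ∀ {n} → Prb n → Set where
  inst : ∀ {n} (α β : Prb n) → ∨StarII ((! ¿ α ∨ ! ¿ β) ⇔ᵦ ! (¿ α ∨ ¿ β))

data ∨StarIII : ∀ {n} → Prb n → Set where
  inst : ∀ {n} (p q : Prp n) → ∨StarIII ((! p ∨ ! q) ⇔ᵦ ∇ (! p ∨ ! q))

data ∨StarIV : ∀ {n} → Prb n → Set where
  inst : ∀ {n} (α β : Prb n) → ∨StarIV ((∇ α ∨ ∇ β) ⇔ᵦ ∇ (α ∨ β))

data ∃StarI : ∀ {n} → Prb n → Set where
  inst : ∀ {n} (p : Prp (suc n)) → ∃StarI (∃' (! p) ⇔ᵦ ! ∃' (□ p))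

data ∃StarII : ∀ {n} → Prb n → Set where
  inst : ∀ {n} (α : Prb (suc n)) → ∃StarII (∃' (! ¿ α) ⇔ᵦ ! ∃' (¿ α))

data ∃StarIII : ∀ {n} → Prb n → Set where
  inst : ∀ {n} (p : Prp (suc n)) → ∃StarIII (∃' (! p) ⇔ᵦ ∇ (∃' (! p)))

data ∃StarIV : ∀ {n} → Prb n → Set where
  inst : ∀ {n} (α : Prb (suc n)) → ∃StarIV (∃' (∇ α) ⇔ᵦ ∇ (∃' α))

-- ? and ! form a Galois connection: ?α → p is derivable iff α → !p is (via the unit
-- α → !?α and the counit ?!p → p).  Hence □ = ?! is an interior operator on
-- propositions, ∇ = !? a closure operator on problems, and the triangle identities
-- ?∇α ↔ ?α and ∇!p ↔ !p hold.  Each principle says that an implication between a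
-- connective and one of ?, !, □, ∇ which is always derivable can be reversed.  The
-- variants arise from one another by instantiating at formulas of the form ?α or !p
-- and collapsing with the triangle identities; each part is a cycle of such steps.
module Submission where

open import Data.Nat using (suc)
open import Data.Fin using (zero; suc)
open import Data.Vec using (Vec; []; _∷_)
open import Data.Product using (_×_; _,_; proj₁; proj₂)
open import Relation.Binary.PropositionalEquality
  using (_≡_; _≗_; refl; cong; cong₂; subst; module ≡-Reasoning)

open import Defs

_∘ˢ_ : ∀ {n m k} → Sub m k → Sub n m → Sub n k
(σ ∘ˢ τ) i = substTm σ (τ i)

wkS : ∀ {n} → Sub n (suc n)
wkS i = var (suc i)

mutual
  substTm-∘ : ∀ {n m k} (σ : Sub m k) (τ : Sub n m) (t : Term n) →
              substTm σ (substTm τ t) ≡ substTm (σ ∘ˢ τ) t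
  substTm-∘ σ τ (var i)      = refl
  substTm-∘ σ τ (fun f k ts) = cong (fun f k) (substTms-∘ σ τ ts)

  substTms-∘ : ∀ {n m k j} (σ : Sub m k) (τ : Sub n m) (ts : Vec (Term n) j) →
               substTms σ (substTms τ ts) ≡ substTms (σ ∘ˢ τ) ts
  substTms-∘ σ τ []       = refl
  substTms-∘ σ τ (t ∷ ts) = cong₂ _∷_ (substTm-∘ σ τ t) (substTms-∘ σ τ ts)

module _ {n m} {σ : Sub m n} {τ : Sub n m} (σ∘τ≗var : σ ∘ˢ τ ≗ var) where

  mutual
    substTm-cancel : (t : Term n) → substTm σ (substTm τ t) ≡ t
    substTm-cancel (var i)      = σ∘τ≗var i
    substTm-cancel (fun f k ts) = cong (fun f k) (substTms-cancel ts)

    substTms-cancel : ∀ {j} (ts : Vec (Term n) j) → substTms σ (substTms τ ts) ≡ ts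
    substTms-cancel []       = refl
    substTms-cancel (t ∷ ts) = cong₂ _∷_ (substTm-cancel t) (substTms-cancel ts)

  liftS-cancel : liftS σ ∘ˢ liftS τ ≗ var
  liftS-cancel zero    = refl
  liftS-cancel (suc i) = begin
    substTm (liftS σ) (substTm wkS (τ i)) ≡⟨ substTm-∘ (liftS σ) wkS (τ i) ⟩
    substTm (wkS ∘ˢ σ) (τ i)              ≡⟨ substTm-∘ wkS σ (τ i) ⟨
    substTm wkS (substTm σ (τ i))         ≡⟨ cong (substTm wkS) (σ∘τ≗var i) ⟩
    var (suc i)                           ∎
    where open ≡-Reasoning

mutual
  substP-cancel : ∀ {n m} {σ : Sub m n} {τ : Sub n m} → σ ∘ˢ τ ≗ var →
                  (A : Prp n) → substP σ (substP τ A) ≡ A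
  substP-cancel h (patom r k ts) = cong (patom r k) (substTms-cancel h ts)
  substP-cancel h (¿ α)   = cong ¿_ (substB-cancel h α)
  substP-cancel h (A ∧ B) = cong₂ _∧_ (substP-cancel h A) (substP-cancel h B)
  substP-cancel h (A ∨ B) = cong₂ _∨_ (substP-cancel h A) (substP-cancel h B)
  substP-cancel h (A ⇒ B) = cong₂ _⇒_ (substP-cancel h A) (substP-cancel h B)
  substP-cancel h (¬ A)   = cong ¬_ (substP-cancel h A)
  substP-cancel h 𝟘       = refl
  substP-cancel h (∀' A)  = cong ∀' (substP-cancel (liftS-cancel h) A)
  substP-cancel h (∃' A)  = cong ∃' (substP-cancel (liftS-cancel h) A)

  substB-cancel : ∀ {n m} {σ : Sub m n} {τ : Sub n m} → σ ∘ˢ τ ≗ var →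
                  (A : Prb n) → substB σ (substB τ A) ≡ A
  substB-cancel h (batom r k ts) = cong (batom r k) (substTms-cancel h ts)
  substB-cancel h (! p)   = cong !_ (substP-cancel h p)
  substB-cancel h (A ∧ B) = cong₂ _∧_ (substB-cancel h A) (substB-cancel h B)
  substB-cancel h (A ∨ B) = cong₂ _∨_ (substB-cancel h A) (substB-cancel h B)
  substB-cancel h (A ⇒ B) = cong₂ _⇒_ (substB-cancel h A) (substB-cancel h B)
  substB-cancel h (¬ A)   = cong ¬_ (substB-cancel h A)
  substB-cancel h ⊥'      = refl
  substB-cancel h (∀' A)  = cong ∀' (substB-cancel (liftS-cancel h) A)
  substB-cancel h (∃' A)  = cong ∃' (substB-cancel (liftS-cancel h) A)

sub0-var-cancel : ∀ {n} → sub0 (var zero) ∘ˢ liftS (wkS {n}) ≗ var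
sub0-var-cancel zero    = refl
sub0-var-cancel (suc i) = refl

instP-wk : ∀ {n} (A : Prp (suc n)) → instP (substP (liftS wkS) A) (var zero) ≡ A
instP-wk = substP-cancel sub0-var-cancel

instB-wk : ∀ {n} (A : Prb (suc n)) → instB (substB (liftS wkS) A) (var zero) ≡ A
instB-wk = substB-cancel sub0-var-cancel

module Positive {F : Set} (_⊃_ _&_ _+_ : F → F → F) (D : F → Set)
  (k     : ∀ {A B} → D (A ⊃ (B ⊃ A)))
  (s     : ∀ {A B C} → D ((A ⊃ B) ⊃ ((A ⊃ (B ⊃ C)) ⊃ (A ⊃ C))))
  (&-I   : ∀ {A B} → D (A ⊃ (B ⊃ (A & B))))
  (&-E₁  : ∀ {A B} → D ((A & B) ⊃ A))
  (&-E₂  : ∀ {A B} → D ((A & B) ⊃ B))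
  (+-I₁  : ∀ {A B} → D (A ⊃ (A + B)))
  (+-I₂  : ∀ {A B} → D (B ⊃ (A + B)))
  (+-E   : ∀ {A B C} → D ((A ⊃ C) ⊃ ((B ⊃ C) ⊃ ((A + B) ⊃ C))))
  (mp    : ∀ {A B} → D (A ⊃ B) → D A → D B) where

  ⇒-const : ∀ {A B} → D B → D (A ⊃ B)
  ⇒-const = mp k

  ⇒-ap : ∀ {C A B} → D (C ⊃ (A ⊃ B)) → D (C ⊃ A) → D (C ⊃ B)
  ⇒-ap f a = mp (mp s a) f

  ⇒-refl : ∀ {A} → D (A ⊃ A)
  ⇒-refl {A} = ⇒-ap (k {B = A ⊃ A}) (k {B = A})

  ⇒-trans : ∀ {A B C} → D (A ⊃ B) → D (B ⊃ C) → D (A ⊃ C)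
  ⇒-trans f g = ⇒-ap (⇒-const g) f

  ⇒-monoʳ : ∀ {A B B'} → D (B ⊃ B') → D ((A ⊃ B) ⊃ (A ⊃ B'))
  ⇒-monoʳ g = ⇒-ap (⇒-ap (⇒-const s) ⇒-refl) (⇒-const (⇒-const g))

  ⇒-monoˡ : ∀ {A A' B} → D (A' ⊃ A) → D ((A ⊃ B) ⊃ (A' ⊃ B))
  ⇒-monoˡ f = ⇒-ap (⇒-ap (⇒-const s) (⇒-const f)) k

  ⇒-mono : ∀ {A A' B B'} → D (A' ⊃ A) → D (B ⊃ B') → D ((A ⊃ B) ⊃ (A' ⊃ B'))
  ⇒-mono f g = ⇒-trans (⇒-monoʳ g) (⇒-monoˡ f)

  ∨-elim : ∀ {A B C} → D (A ⊃ C) → D (B ⊃ C) → D ((A + B) ⊃ C)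
  ∨-elim f g = mp (mp +-E f) g

  ∨-map : ∀ {A A' B B'} → D (A ⊃ A') → D (B ⊃ B') → D ((A + B) ⊃ (A' + B'))
  ∨-map f g = ∨-elim (⇒-trans f +-I₁) (⇒-trans g +-I₂)

  ⇔-intro : ∀ {A B} → D (A ⊃ B) → D (B ⊃ A) → D ((A ⊃ B) & (B ⊃ A))
  ⇔-intro f g = mp (mp &-I f) g

  ⇔-to : ∀ {A B} → D ((A ⊃ B) & (B ⊃ A)) → D (A ⊃ B)
  ⇔-to = mp &-E₁

  ⇔-from : ∀ {A B} → D ((A ⊃ B) & (B ⊃ A)) → D (B ⊃ A)
  ⇔-from = mp &-E₂

open module Positiveₚ {X} {n} = Positive {Prp n} _⇒_ _∧_ _∨_ (X ⊢ₚ_) K S ∧I ∧E₁ ∧E₂ ∨I₁ ∨I₂ ∨E MP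
  using () renaming (⇒-trans to ⇒-transₚ; ⇒-mono to ⇒-monoₚ; ∨-elim to ∨-elimₚ;
                     ⇔-intro to ⇔-introₚ; ⇔-to to ⇔-toₚ)
open module Positiveᵦ {X} {n} = Positive {Prb n} _⇒_ _∧_ _∨_ (X ⊢ᵦ_) K S ∧I ∧E₁ ∧E₂ ∨I₁ ∨I₂ ∨E MP
  using () renaming (⇒-trans to ⇒-transᵦ; ⇒-mono to ⇒-monoᵦ; ∨-elim to ∨-elimᵦ;
                     ∨-map to ∨-mapᵦ; ⇔-intro to ⇔-introᵦ; ⇔-from to ⇔-fromᵦ)

module _ {X : Principle} where

  ¿-mono : ∀ {n} {α β : Prb n} → X ⊢ᵦ α ⇒ β → X ⊢ₚ ¿ α ⇒ ¿ β
  ¿-mono d = MP ?K (?R d)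

  !-mono : ∀ {n} {p q : Prp n} → X ⊢ₚ p ⇒ q → X ⊢ᵦ ! p ⇒ ! q
  !-mono d = MP !K (!R d)

  transpose-! : ∀ {n} {α : Prb n} {p : Prp n} → X ⊢ₚ ¿ α ⇒ p → X ⊢ᵦ α ⇒ ! p
  transpose-! d = ⇒-transᵦ unit (!-mono d)

  transpose-¿ : ∀ {n} {α : Prb n} {p : Prp n} → X ⊢ᵦ α ⇒ ! p → X ⊢ₚ ¿ α ⇒ p
  transpose-¿ d = ⇒-transₚ (¿-mono d) ?!T

  □-intro : ∀ {n} {γ : Prb n} {p : Prp n} → X ⊢ₚ ¿ γ ⇒ p → X ⊢ₚ ¿ γ ⇒ □ p
  □-intro d = ¿-mono (transpose-! d)

  ∇-elim : ∀ {n} {γ : Prb n} {p : Prp n} → X ⊢ᵦ γ ⇒ ! p → X ⊢ᵦ ∇ γ ⇒ ! p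
  ∇-elim d = !-mono (transpose-¿ d)

  ¿⇒¿∇ : ∀ {n} {α : Prb n} → X ⊢ₚ ¿ α ⇒ ¿ ∇ α
  ¿⇒¿∇ = ¿-mono unit

  ∇!⇒! : ∀ {n} {p : Prp n} → X ⊢ᵦ ∇ (! p) ⇒ ! p
  ∇!⇒! = !-mono ?!T

  ¿∨¿⇒¿∨ : ∀ {n} {α β : Prb n} → X ⊢ₚ (¿ α ∨ ¿ β) ⇒ ¿ (α ∨ β)
  ¿∨¿⇒¿∨ = ∨-elimₚ (¿-mono ∨I₁) (¿-mono ∨I₂)

  !∨!⇒!∨ : ∀ {n} {p q : Prp n} → X ⊢ᵦ (! p ∨ ! q) ⇒ ! (p ∨ q)
  !∨!⇒!∨ = ∨-elimᵦ (!-mono ∨I₁) (!-mono ∨I₂)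

  ∀-elim₀ₚ : ∀ {n} (A : Prp (suc n)) → X ⊢ₚ wkP (∀' A) ⇒ A
  ∀-elim₀ₚ A = subst (λ B → X ⊢ₚ wkP (∀' A) ⇒ B) (instP-wk A) (∀E _ (var zero))

  ∀-elim₀ᵦ : ∀ {n} (A : Prb (suc n)) → X ⊢ᵦ wkB (∀' A) ⇒ A
  ∀-elim₀ᵦ A = subst (λ B → X ⊢ᵦ wkB (∀' A) ⇒ B) (instB-wk A) (∀E _ (var zero))

  ∃-intro₀ₚ : ∀ {n} (A : Prp (suc n)) → X ⊢ₚ A ⇒ wkP (∃' A)
  ∃-intro₀ₚ A = subst (λ B → X ⊢ₚ B ⇒ wkP (∃' A)) (instP-wk A) (∃I _ (var zero))

  ∃-intro₀ᵦ : ∀ {n} (A : Prb (suc n)) → X ⊢ᵦ A ⇒ wkB (∃' A)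
  ∃-intro₀ᵦ A = subst (λ B → X ⊢ᵦ B ⇒ wkB (∃' A)) (instB-wk A) (∃I _ (var zero))

  ∀-monoₚ : ∀ {n} {A B : Prp (suc n)} → X ⊢ₚ A ⇒ B → X ⊢ₚ ∀' A ⇒ ∀' B
  ∀-monoₚ {A = A} d = Gen (⇒-transₚ (∀-elim₀ₚ A) d)

  ∃-monoᵦ : ∀ {n} {A B : Prb (suc n)} → X ⊢ᵦ A ⇒ B → X ⊢ᵦ ∃' A ⇒ ∃' B
  ∃-monoᵦ {B = B} d = ∃E (⇒-transᵦ d (∃-intro₀ᵦ B))

  ¿∀⇒∀¿ : ∀ {n} {α : Prb (suc n)} → X ⊢ₚ ¿ ∀' α ⇒ ∀' (¿ α)
  ¿∀⇒∀¿ {α = α} = Gen (¿-mono (∀-elim₀ᵦ α))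

  !∀⇒∀! : ∀ {n} {p : Prp (suc n)} → X ⊢ᵦ ! ∀' p ⇒ ∀' (! p)
  !∀⇒∀! {p = p} = Gen (!-mono (∀-elim₀ₚ p))

  ∃¿⇒¿∃ : ∀ {n} {α : Prb (suc n)} → X ⊢ₚ ∃' (¿ α) ⇒ ¿ ∃' α
  ∃¿⇒¿∃ {α = α} = ∃E (¿-mono (∃-intro₀ᵦ α))

  ∃!⇒!∃ : ∀ {n} {p : Prp (suc n)} → X ⊢ᵦ ∃' (! p) ⇒ ! ∃' p
  ∃!⇒!∃ {p = p} = ∃E (!-mono (∃-intro₀ₚ p))

module _ {P Q : Principle} (P⊑Q : P ⊑ Q) where

  mutual
    lift⊢ₚ : ∀ {n} {A : Prp n} → Q ⊢ₚ A → P ⊢ₚ A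
    lift⊢ₚ K         = K
    lift⊢ₚ S         = S
    lift⊢ₚ ∧I        = ∧I
    lift⊢ₚ ∧E₁       = ∧E₁
    lift⊢ₚ ∧E₂       = ∧E₂
    lift⊢ₚ ∨I₁       = ∨I₁
    lift⊢ₚ ∨I₂       = ∨I₂
    lift⊢ₚ ∨E        = ∨E
    lift⊢ₚ ¬I        = ¬I
    lift⊢ₚ ¬E        = ¬E
    lift⊢ₚ 𝟘E        = 𝟘E
    lift⊢ₚ DNE       = DNE
    lift⊢ₚ (MP d e)  = MP (lift⊢ₚ d) (lift⊢ₚ e)
    lift⊢ₚ (∀E A t)  = ∀E A t
    lift⊢ₚ (∃I A t)  = ∃I A t
    lift⊢ₚ (Gen d)   = Gen (lift⊢ₚ d)
    lift⊢ₚ (∃E d)    = ∃E (lift⊢ₚ d)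
    lift⊢ₚ (?R d)    = ?R (lift⊢ᵦ d)
    lift⊢ₚ ?K        = ?K
    lift⊢ₚ ?!T       = ?!T
    lift⊢ₚ (axP a)   = proj₁ P⊑Q _ a

    lift⊢ᵦ : ∀ {n} {A : Prb n} → Q ⊢ᵦ A → P ⊢ᵦ A
    lift⊢ᵦ K         = K
    lift⊢ᵦ S         = S
    lift⊢ᵦ ∧I        = ∧I
    lift⊢ᵦ ∧E₁       = ∧E₁
    lift⊢ᵦ ∧E₂       = ∧E₂
    lift⊢ᵦ ∨I₁       = ∨I₁
    lift⊢ᵦ ∨I₂       = ∨I₂
    lift⊢ᵦ ∨E        = ∨E
    lift⊢ᵦ ¬I        = ¬I
    lift⊢ᵦ ¬E        = ¬E
    lift⊢ᵦ ⊥E        = ⊥E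
    lift⊢ᵦ (MP d e)  = MP (lift⊢ᵦ d) (lift⊢ᵦ e)
    lift⊢ᵦ (∀E A t)  = ∀E A t
    lift⊢ᵦ (∃I A t)  = ∃I A t
    lift⊢ᵦ (Gen d)   = Gen (lift⊢ᵦ d)
    lift⊢ᵦ (∃E d)    = ∃E (lift⊢ᵦ d)
    lift⊢ᵦ (!R d)    = !R (lift⊢ₚ d)
    lift⊢ᵦ !K        = !K
    lift⊢ᵦ ¬!0       = ¬!0
    lift⊢ᵦ unit      = unit
    lift⊢ᵦ (axB a)   = proj₂ P⊑Q _ a

⊑-trans : ∀ {P Q R} → P ⊑ Q → Q ⊑ R → P ⊑ R
⊑-trans P⊑Q Q⊑R = (λ A a → lift⊢ₚ P⊑Q (proj₁ Q⊑R A a))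
                , (λ A a → lift⊢ᵦ P⊑Q (proj₂ Q⊑R A a))

⊑-cycle₃ : ∀ {P Q₁ Q₂} → P ⊑ Q₂ → Q₂ ⊑ Q₁ → Q₁ ⊑ P → (P ≋ Q₁) × (P ≋ Q₂)
⊑-cycle₃ P⊑Q₂ Q₂⊑Q₁ Q₁⊑P = (⊑-trans P⊑Q₂ Q₂⊑Q₁ , Q₁⊑P) , (P⊑Q₂ , ⊑-trans Q₂⊑Q₁ Q₁⊑P)

⊑-cycle₄ : ∀ {P Q₁ Q₂ Q₃} → P ⊑ Q₂ → Q₂ ⊑ Q₃ → Q₃ ⊑ Q₁ → Q₁ ⊑ P →
           (P ≋ Q₁) × (P ≋ Q₂) × (P ≋ Q₃)
⊑-cycle₄ P⊑Q₂ Q₂⊑Q₃ Q₃⊑Q₁ Q₁⊑P =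
  (⊑-trans P⊑Q₂ (⊑-trans Q₂⊑Q₃ Q₃⊑Q₁) , Q₁⊑P) ,
  (P⊑Q₂ , ⊑-trans Q₂⊑Q₃ (⊑-trans Q₃⊑Q₁ Q₁⊑P)) ,
  (⊑-trans P⊑Q₂ Q₂⊑Q₃ , ⊑-trans Q₃⊑Q₁ Q₁⊑P)

⊑-prop : ∀ {P} {I : ∀ {n} → Prp n → Set} → (∀ {n} (A : Prp n) → I A → P ⊢ₚ A) →
         P ⊑ propPrinciple I
⊑-prop derive = derive , λ _ ()

⊑-prob : ∀ {P} {I : ∀ {n} → Prb n → Set} → (∀ {n} (A : Prb n) → I A → P ⊢ᵦ A) →
         P ⊑ probPrinciple I
⊑-prob derive = (λ _ ()) , derive

?StarI-⇐ : ∀ {X n} {α β : Prb n} → X ⊢ₚ ¿ (∇ α ⇒ ∇ β) ⇒ (¿ α ⇒ ¿ β)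
?StarI-⇐ = ⇒-transₚ ?K (⇒-monoₚ ¿⇒¿∇ ?!T)

?StarI⊑?StarIII : propPrinciple ?StarI ⊑ propPrinciple ?StarIII
?StarI⊑?StarIII = ⊑-prop λ { _ (inst α β) →
  ⇔-introₚ (⇒-transₚ (⇔-toₚ (axP (inst α β))) (□-intro ?StarI-⇐)) ?!T }

?StarIII⊑?StarII : propPrinciple ?StarIII ⊑ propPrinciple ?StarII
?StarIII⊑?StarII = ⊑-prop λ { _ (inst p q) →
  ⇔-introₚ (⇒-transₚ (⇔-toₚ (axP (inst (! p) (! q))))
                      (¿-mono (⇒-transᵦ !K (⇒-monoᵦ unit ∇!⇒!))))
           ?K }

?StarII⊑?StarI : propPrinciple ?StarII ⊑ propPrinciple ?StarI
?StarII⊑?StarI = ⊑-prop λ { _ (inst α β) →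
  ⇔-introₚ (⇒-transₚ (⇒-monoₚ ?!T ¿⇒¿∇) (⇔-toₚ (axP (inst (¿ α) (¿ β))))) ?StarI-⇐ }

∀StarI-⇐ : ∀ {X n} {α : Prb (suc n)} → X ⊢ₚ ¿ ∀' (∇ α) ⇒ ∀' (¿ α)
∀StarI-⇐ = ⇒-transₚ ¿∀⇒∀¿ (∀-monoₚ ?!T)

∀StarI⊑∀StarIII : propPrinciple ∀StarI ⊑ propPrinciple ∀StarIII
∀StarI⊑∀StarIII = ⊑-prop λ { _ (inst α) →
  ⇔-introₚ (⇒-transₚ (⇔-toₚ (axP (inst α))) (□-intro ∀StarI-⇐)) ?!T }

∀StarIII⊑∀StarIV : propPrinciple ∀StarIII ⊑ propPrinciple ∀StarIV
∀StarIII⊑∀StarIV = ⊑-prop λ { _ (inst p) →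
  ⇔-introₚ (⇒-transₚ (⇔-toₚ (axP (inst (! p)))) (¿-mono (!-mono (∀-monoₚ ?!T))))
           (⇒-transₚ (¿-mono !∀⇒∀!) ¿∀⇒∀¿) }

∀StarIV⊑∀StarII : propPrinciple ∀StarIV ⊑ propPrinciple ∀StarII
∀StarIV⊑∀StarII = ⊑-prop λ { _ (inst p) →
  ⇔-introₚ (⇒-transₚ (⇔-toₚ (axP (inst p))) (¿-mono !∀⇒∀!)) ¿∀⇒∀¿ }

∀StarII⊑∀StarI : propPrinciple ∀StarII ⊑ propPrinciple ∀StarI
∀StarII⊑∀StarI = ⊑-prop λ { _ (inst α) →
  ⇔-introₚ (⇒-transₚ (∀-monoₚ ¿⇒¿∇) (⇔-toₚ (axP (inst (¿ α))))) ∀StarI-⇐ }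

∨StarI-⇒ : ∀ {X n} {p q : Prp n} → X ⊢ᵦ (! p ∨ ! q) ⇒ ! (□ p ∨ □ q)
∨StarI-⇒ = ⇒-transᵦ (∨-mapᵦ unit unit) !∨!⇒!∨

∨StarI⊑∨StarIII : probPrinciple ∨StarI ⊑ probPrinciple ∨StarIII
∨StarI⊑∨StarIII = ⊑-prob λ { _ (inst p q) →
  ⇔-introᵦ unit (⇒-transᵦ (∇-elim ∨StarI-⇒) (⇔-fromᵦ (axB (inst p q)))) }

∨StarIII⊑∨StarIV : probPrinciple ∨StarIII ⊑ probPrinciple ∨StarIV
∨StarIII⊑∨StarIV = ⊑-prob λ { _ (inst α β) →
  ⇔-introᵦ (⇒-transᵦ !∨!⇒!∨ (!-mono ¿∨¿⇒¿∨))
           (⇒-transᵦ (!-mono (¿-mono (∨-mapᵦ unit unit))) (⇔-fromᵦ (axB (inst (¿ α) (¿ β))))) }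

∨StarIV⊑∨StarII : probPrinciple ∨StarIV ⊑ probPrinciple ∨StarII
∨StarIV⊑∨StarII = ⊑-prob λ { _ (inst α β) →
  ⇔-introᵦ !∨!⇒!∨ (⇒-transᵦ (!-mono ¿∨¿⇒¿∨) (⇔-fromᵦ (axB (inst α β)))) }

∨StarII⊑∨StarI : probPrinciple ∨StarII ⊑ probPrinciple ∨StarI
∨StarII⊑∨StarI = ⊑-prob λ { _ (inst p q) →
  ⇔-introᵦ ∨StarI-⇒ (⇒-transᵦ (⇔-fromᵦ (axB (inst (! p) (! q)))) (∨-mapᵦ ∇!⇒! ∇!⇒!)) }

∃StarI-⇒ : ∀ {X n} {p : Prp (suc n)} → X ⊢ᵦ ∃' (! p) ⇒ ! ∃' (□ p)
∃StarI-⇒ = ⇒-transᵦ (∃-monoᵦ unit) ∃!⇒!∃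

∃StarI⊑∃StarIII : probPrinciple ∃StarI ⊑ probPrinciple ∃StarIII
∃StarI⊑∃StarIII = ⊑-prob λ { _ (inst p) →
  ⇔-introᵦ unit (⇒-transᵦ (∇-elim ∃StarI-⇒) (⇔-fromᵦ (axB (inst p)))) }

∃StarIII⊑∃StarIV : probPrinciple ∃StarIII ⊑ probPrinciple ∃StarIV
∃StarIII⊑∃StarIV = ⊑-prob λ { _ (inst α) →
  ⇔-introᵦ (⇒-transᵦ ∃!⇒!∃ (!-mono ∃¿⇒¿∃))
           (⇒-transᵦ (!-mono (¿-mono (∃-monoᵦ unit))) (⇔-fromᵦ (axB (inst (¿ α))))) }

∃StarIV⊑∃StarII : probPrinciple ∃StarIV ⊑ probPrinciple ∃StarII
∃StarIV⊑∃StarII = ⊑-prob λ { _ (inst α) →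
  ⇔-introᵦ ∃!⇒!∃ (⇒-transᵦ (!-mono ∃¿⇒¿∃) (⇔-fromᵦ (axB (inst α)))) }

∃StarII⊑∃StarI : probPrinciple ∃StarII ⊑ probPrinciple ∃StarI
∃StarII⊑∃StarI = ⊑-prob λ { _ (inst p) →
  ⇔-introᵦ ∃StarI-⇒ (⇒-transᵦ (⇔-fromᵦ (axB (inst (! p)))) (∃-monoᵦ ∇!⇒!)) }

mainTheorem3 : ((propPrinciple ?StarI ≋ propPrinciple ?StarII)
                 × (propPrinciple ?StarI ≋ propPrinciple ?StarIII))
             × ((propPrinciple ∀StarI ≋ propPrinciple ∀StarII)
                 × (propPrinciple ∀StarI ≋ propPrinciple ∀StarIII)
                 × (propPrinciple ∀StarI ≋ propPrinciple ∀StarIV))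
             × ((probPrinciple ∨StarI ≋ probPrinciple ∨StarII)
                 × (probPrinciple ∨StarI ≋ probPrinciple ∨StarIII)
                 × (probPrinciple ∨StarI ≋ probPrinciple ∨StarIV))
             × ((probPrinciple ∃StarI ≋ probPrinciple ∃StarII)
                 × (probPrinciple ∃StarI ≋ probPrinciple ∃StarIII)
                 × (probPrinciple ∃StarI ≋ probPrinciple ∃StarIV))
mainTheorem3 =
    ⊑-cycle₃ ?StarI⊑?StarIII ?StarIII⊑?StarII ?StarII⊑?StarI
  , ⊑-cycle₄ ∀StarI⊑∀StarIII ∀StarIII⊑∀StarIV ∀StarIV⊑∀StarII ∀StarII⊑∀StarI
  , ⊑-cycle₄ ∨StarI⊑∨StarIII ∨StarIII⊑∨StarIV ∨StarIV⊑∨StarII ∨StarII⊑∨StarI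
  , ⊑-cycle₄ ∃StarI⊑∃StarIII ∃StarIII⊑∃StarIV ∃StarIV⊑∃StarII ∃StarII⊑∃StarI
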